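{- Let $H_5$ be the 5-gate (defined in the context) and let $x,y$ be two distinct vertices chosen from its attachment vertices $\{1,2,9,11,13\}$. Then $H_5$ contains a Hamiltonian path (visiting each of its 13 vertices exactly once) with endpoints $x$ and $y$. Equivalently, one can enter the 5-gate via any external edge and exit via any other external edge, visiting every vertex exactly once.
   Context: The 5-gate $H_5$ is the simple undirected graph on vertex set $\{1,\dots,13\}$ with the 17 edges $\{1,3\},\{1,8\},\{1,12\},\{2,3\},\{2,5\},\{3,4\},\{4,5\},\{4,6\},\{6,7\},\{7,8\},\{7,10\},\{8,9\},\{9,10\},\{10,13\},\{12,13\},\{11,12\},\{5,11\}$. When used inside a larger graph it has five external edges, one incident to each of the attachment vertices $1,2,9,11,13$. -}

module Defs where

open import Data.Nat using (ℕ; _≤_)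
open import Data.Product using (_×_; Σ-syntax)
open import Data.Sum using (_⊎_)
open import Data.List using (List; []; _∷_; head; last)
open import Data.Maybe using (just)
open import Data.List.Membership.Propositional using (_∈_)
open import Data.List.Relation.Unary.All using (All)
open import Data.List.Relation.Unary.Unique.Propositional using (Unique)
open import Relation.Binary.PropositionalEquality using (_≡_)

Vertex : ℕ → Set
Vertex v = 1 ≤ v × v ≤ 13

data Edge₅ : ℕ → ℕ → Set where
  e1-3   : Edge₅ 1 3
  e1-8   : Edge₅ 1 8
  e1-12  : Edge₅ 1 12
  e2-3   : Edge₅ 2 3
  e2-5   : Edge₅ 2 5
  e3-4   : Edge₅ 3 4
  e4-5   : Edge₅ 4 5
  e4-6   : Edge₅ 4 6
  e6-7   : Edge₅ 6 7
  e7-8   : Edge₅ 7 8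
  e7-10  : Edge₅ 7 10
  e8-9   : Edge₅ 8 9
  e9-10  : Edge₅ 9 10
  e10-13 : Edge₅ 10 13
  e12-13 : Edge₅ 12 13
  e11-12 : Edge₅ 11 12
  e5-11  : Edge₅ 5 11

Adj₅ : ℕ → ℕ → Set
Adj₅ u v = Edge₅ u v ⊎ Edge₅ v u

data Walk : List ℕ → Set where
  walk[]  : Walk []
  walk[_] : (v : ℕ) → Walk (v ∷ [])
  walk∷   : ∀ {u v vs} → Adj₅ u v → Walk (v ∷ vs) → Walk (u ∷ v ∷ vs)

record HamPath₅ (x y : ℕ) (p : List ℕ) : Set where
  field
    isWalk   : Walk p
    noRepeat : Unique p
    onlyVert : All Vertex p
    covers   : ∀ v → Vertex v → v ∈ p
    start    : head p ≡ just x
    end      : last p ≡ just y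

Attachment : ℕ → Set
Attachment v = v ≡ 1 ⊎ v ≡ 2 ⊎ v ≡ 9 ⊎ v ≡ 11 ⊎ v ≡ 13

-- A Hamiltonian path is reversible, so it suffices to exhibit one path for
-- each of the ten unordered pairs of attachment vertices. For a concrete
-- walk, the remaining conditions (no repeated vertex, only vertices of H₅,
-- every vertex visited) are decidable and are checked by evaluation.
module Submission where

open import Defs
open import Data.Nat using (ℕ; suc; _≤?_)
open import Data.Nat.Properties using (_≟_)
open import Data.List using (List; []; _∷_; _∷ʳ_; head; last; reverse; reverseAcc; applyUpTo)
open import Data.List.Properties using (unfold-reverse; reverse-involutive)
open import Data.List.Relation.Unary.All as All using (all?)
open import Data.List.Relation.Unary.Unique.Propositional using (Unique)
open import Data.List.Relation.Unary.Unique.DecPropositional _≟_ using (unique?)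
open import Data.List.Membership.Propositional using (_∈_)
open import Data.List.Membership.Propositional.Properties using (∈-applyUpTo⁺)
open import Data.List.Membership.DecPropositional _≟_ using (_∈?_)
open import Data.List.Relation.Binary.Permutation.Propositional using (_↭_; ↭-sym; ↭⇒↭ₛ)
open import Data.List.Relation.Binary.Permutation.Propositional.Properties using (↭-reverse; All-resp-↭; ∈-resp-↭)
open import Data.List.Relation.Binary.Permutation.Setoid.Properties as Permutationₛ using ()
open import Data.Maybe using (just)
open import Data.Product using (Σ-syntax; _,_)
open import Data.Sum using (inj₁; inj₂; swap)
open import Function using (_∘_)
open import Relation.Nullary using (Dec; contradiction)
open import Relation.Nullary.Decidable using (True; toWitness; _×-dec_)
open import Relation.Binary.PropositionalEquality using (_≡_; _≢_; refl; sym; trans; cong; setoid)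

Adj₅-sym : ∀ {u v} → Adj₅ u v → Adj₅ v u
Adj₅-sym = swap

Walk-reverseAcc : ∀ {v vs acc} → Walk (v ∷ acc) → Walk (v ∷ vs) → Walk (reverseAcc acc (v ∷ vs))
Walk-reverseAcc back walk[ _ ]          = back
Walk-reverseAcc back (walk∷ uv forward) = Walk-reverseAcc (walk∷ (Adj₅-sym uv) back) forward

Walk-reverse : ∀ {p} → Walk p → Walk (reverse p)
Walk-reverse {[]}    w = w
Walk-reverse {v ∷ _} w = Walk-reverseAcc walk[ v ] w

last-∷ʳ : ∀ {a} {A : Set a} (xs : List A) (x : A) → last (xs ∷ʳ x) ≡ just x
last-∷ʳ []           x = refl
last-∷ʳ (_ ∷ [])     x = refl
last-∷ʳ (_ ∷ y ∷ ys) x = last-∷ʳ (y ∷ ys) x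

last-reverse : ∀ {a} {A : Set a} (xs : List A) → last (reverse xs) ≡ head xs
last-reverse []       = refl
last-reverse (x ∷ xs) = trans (cong last (unfold-reverse x xs)) (last-∷ʳ (reverse xs) x)

head-reverse : ∀ {a} {A : Set a} (xs : List A) → head (reverse xs) ≡ last xs
head-reverse xs = trans (sym (last-reverse (reverse xs))) (cong last (reverse-involutive xs))

Unique-reverse : ∀ {a} {A : Set a} {xs : List A} → Unique xs → Unique (reverse xs)
Unique-reverse {A = A} {xs} = Permutationₛ.Unique-resp-↭ (setoid A) (↭⇒↭ₛ (↭-sym (↭-reverse xs)))

HamPath₅-reverse : ∀ {x y p} → HamPath₅ x y p → HamPath₅ y x (reverse p)
HamPath₅-reverse {p = p} h = record
  { isWalk   = Walk-reverse isWalk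
  ; noRepeat = Unique-reverse noRepeat
  ; onlyVert = All-resp-↭ reversal onlyVert
  ; covers   = λ v → ∈-resp-↭ reversal ∘ covers v
  ; start    = trans (head-reverse p) end
  ; end      = trans (last-reverse p) start
  }
  where
  open HamPath₅ h
  reversal : p ↭ reverse p
  reversal = ↭-sym (↭-reverse p)

vertex? : (v : ℕ) → Dec (Vertex v)
vertex? v = (1 ≤? v) ×-dec (v ≤? 13)

vertices : List ℕ
vertices = applyUpTo suc 13

Vertex⇒∈vertices : ∀ {v} → Vertex v → v ∈ vertices
Vertex⇒∈vertices {suc i} (_ , i<13) = ∈-applyUpTo⁺ suc i<13

Traversal : ℕ → ℕ → Set
Traversal x y = Σ[ p ∈ List ℕ ] HamPath₅ x y p

reverseTraversal : ∀ {x y} → Traversal x y → Traversal y x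
reverseTraversal (p , h) = reverse p , HamPath₅-reverse h

traversal : ∀ {p x y} → Walk p → head p ≡ just x → last p ≡ just y →
            {True (unique? p)} → {True (all? vertex? p)} → {True (all? (_∈? p) vertices)} →
            Traversal x y
traversal {p} w start end {distinct} {inside} {visitsAll} = p , record
  { isWalk   = w
  ; noRepeat = toWitness distinct
  ; onlyVert = toWitness inside
  ; covers   = λ _ → All.lookup (toWitness visitsAll) ∘ Vertex⇒∈vertices
  ; start    = start
  ; end      = end
  }

infixr 5 _⟶_ _⟵_

_⟶_ : ∀ {u v vs} → Edge₅ u v → Walk (v ∷ vs) → Walk (u ∷ v ∷ vs)
e ⟶ w = walk∷ (inj₁ e) w

_⟵_ : ∀ {u v vs} → Edge₅ v u → Walk (v ∷ vs) → Walk (u ∷ v ∷ vs)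
e ⟵ w = walk∷ (inj₂ e) w

1⇝2 : Traversal 1 2
1⇝2 = traversal (e1-3 ⟶ e3-4 ⟶ e4-6 ⟶ e6-7 ⟶ e7-8 ⟶ e8-9 ⟶ e9-10 ⟶ e10-13 ⟶ e12-13 ⟵ e11-12 ⟵ e5-11 ⟵ e2-5 ⟵ walk[ 2 ]) refl refl

1⇝9 : Traversal 1 9
1⇝9 = traversal (e1-8 ⟶ e7-8 ⟵ e6-7 ⟵ e4-6 ⟵ e3-4 ⟵ e2-3 ⟵ e2-5 ⟶ e5-11 ⟶ e11-12 ⟶ e12-13 ⟶ e10-13 ⟵ e9-10 ⟵ walk[ 9 ]) refl refl

1⇝11 : Traversal 1 11
1⇝11 = traversal (e1-3 ⟶ e2-3 ⟵ e2-5 ⟶ e4-5 ⟵ e4-6 ⟶ e6-7 ⟶ e7-8 ⟶ e8-9 ⟶ e9-10 ⟶ e10-13 ⟶ e12-13 ⟵ e11-12 ⟵ walk[ 11 ]) refl refl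

1⇝13 : Traversal 1 13
1⇝13 = traversal (e1-8 ⟶ e8-9 ⟶ e9-10 ⟶ e7-10 ⟵ e6-7 ⟵ e4-6 ⟵ e3-4 ⟵ e2-3 ⟵ e2-5 ⟶ e5-11 ⟶ e11-12 ⟶ e12-13 ⟶ walk[ 13 ]) refl refl

2⇝9 : Traversal 2 9
2⇝9 = traversal (e2-3 ⟶ e1-3 ⟵ e1-8 ⟶ e7-8 ⟵ e6-7 ⟵ e4-6 ⟵ e4-5 ⟶ e5-11 ⟶ e11-12 ⟶ e12-13 ⟶ e10-13 ⟵ e9-10 ⟵ walk[ 9 ]) refl refl

2⇝11 : Traversal 2 11
2⇝11 = traversal (e2-3 ⟶ e1-3 ⟵ e1-12 ⟶ e12-13 ⟶ e10-13 ⟵ e9-10 ⟵ e8-9 ⟵ e7-8 ⟵ e6-7 ⟵ e4-6 ⟵ e4-5 ⟶ e5-11 ⟶ walk[ 11 ]) refl refl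

2⇝13 : Traversal 2 13
2⇝13 = traversal (e2-3 ⟶ e1-3 ⟵ e1-8 ⟶ e8-9 ⟶ e9-10 ⟶ e7-10 ⟵ e6-7 ⟵ e4-6 ⟵ e4-5 ⟶ e5-11 ⟶ e11-12 ⟶ e12-13 ⟶ walk[ 13 ]) refl refl

9⇝11 : Traversal 9 11
9⇝11 = traversal (e8-9 ⟵ e1-8 ⟵ e1-3 ⟶ e2-3 ⟵ e2-5 ⟶ e4-5 ⟵ e4-6 ⟶ e6-7 ⟶ e7-10 ⟶ e10-13 ⟶ e12-13 ⟵ e11-12 ⟵ walk[ 11 ]) refl refl

9⇝13 : Traversal 9 13
9⇝13 = traversal (e8-9 ⟵ e1-8 ⟵ e1-12 ⟶ e11-12 ⟵ e5-11 ⟵ e2-5 ⟵ e2-3 ⟶ e3-4 ⟶ e4-6 ⟶ e6-7 ⟶ e7-10 ⟶ e10-13 ⟶ walk[ 13 ]) refl refl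

11⇝13 : Traversal 11 13
11⇝13 = traversal (e5-11 ⟵ e2-5 ⟵ e2-3 ⟶ e3-4 ⟶ e4-6 ⟶ e6-7 ⟶ e7-10 ⟶ e9-10 ⟵ e8-9 ⟵ e1-8 ⟵ e1-12 ⟶ e12-13 ⟶ walk[ 13 ]) refl refl

pattern at1  = inj₁ refl
pattern at2  = inj₂ (inj₁ refl)
pattern at9  = inj₂ (inj₂ (inj₁ refl))
pattern at11 = inj₂ (inj₂ (inj₂ (inj₁ refl)))
pattern at13 = inj₂ (inj₂ (inj₂ (inj₂ refl)))

lemma3p3 : (x y : ℕ) → Attachment x → Attachment y → x ≢ y →
    Σ[ p ∈ List ℕ ] HamPath₅ x y p
lemma3p3 _ _ at1  at1  x≢y = contradiction refl x≢y
lemma3p3 _ _ at1  at2  _   = 1⇝2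
lemma3p3 _ _ at1  at9  _   = 1⇝9
lemma3p3 _ _ at1  at11 _   = 1⇝11
lemma3p3 _ _ at1  at13 _   = 1⇝13
lemma3p3 _ _ at2  at1  _   = reverseTraversal 1⇝2
lemma3p3 _ _ at2  at2  x≢y = contradiction refl x≢y
lemma3p3 _ _ at2  at9  _   = 2⇝9
lemma3p3 _ _ at2  at11 _   = 2⇝11
lemma3p3 _ _ at2  at13 _   = 2⇝13
lemma3p3 _ _ at9  at1  _   = reverseTraversal 1⇝9
lemma3p3 _ _ at9  at2  _   = reverseTraversal 2⇝9
lemma3p3 _ _ at9  at9  x≢y = contradiction refl x≢y
lemma3p3 _ _ at9  at11 _   = 9⇝11
lemma3p3 _ _ at9  at13 _   = 9⇝13
lemma3p3 _ _ at11 at1  _   = reverseTraversal 1⇝11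
lemma3p3 _ _ at11 at2  _   = reverseTraversal 2⇝11
lemma3p3 _ _ at11 at9  _   = reverseTraversal 9⇝11
lemma3p3 _ _ at11 at11 x≢y = contradiction refl x≢y
lemma3p3 _ _ at11 at13 _   = 11⇝13
lemma3p3 _ _ at13 at1  _   = reverseTraversal 1⇝13
lemma3p3 _ _ at13 at2  _   = reverseTraversal 2⇝13
lemma3p3 _ _ at13 at9  _   = reverseTraversal 9⇝13
lemma3p3 _ _ at13 at11 _   = reverseTraversal 11⇝13
lemma3p3 _ _ at13 at13 x≢y = contradiction refl x≢y
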